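{- Let $J$ be a matching covered graph with minimum degree $\delta(J)\ge 3$, let $G$ be a matching covered graph, let $H$ be a conformal subgraph of $G$ that is a bisubdivision of $J$, and let $B$ be a barrier of $G$. If $G-B$ has distinct components $K$ and $L$ each containing exactly one branch vertex of $H$, say $u\in V(K)$ and $v\in V(L)$, then $u$ and $v$ are nonadjacent in $J$.
   Context: Graphs loopless; multiple edges allowed. A connected graph with at least two vertices is matching covered if every edge lies in a perfect matching. A subgraph $H$ of $G$ is conformal if $G-V(H)$ has a perfect matching. A bisubdivision of $J$ is obtained by replacing some (possibly none) of the edges of $J$ by paths with an even number of internal vertices. The branch vertices of $H$ are its vertices of degree at least three; each corresponds to (and is identified with) a vertex of $J$. A barrier of a graph with a perfect matching is a set $B$ of vertices such that the number of odd components of $G-B$ equals $|B|$. -}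

module Defs where

open import Data.Nat using (ℕ; zero; suc; _+_; _*_; _≤_)
open import Data.Fin using (Fin; zero; suc; inject₁; fromℕ; _≟_)
open import Data.Fin.Subset using (Subset; _∈_; _∉_; ∣_∣) renaming (⊥ to emptySet)
open import Data.Bool using (Bool; true; false; if_then_else_; _∨_)
open import Data.List using (List; length; map; allFin)
open import Data.Nat.ListAction using (sum)
open import Data.List.Relation.Unary.Unique.Propositional using (Unique)
import Data.List.Membership.Propositional as LM
open import Data.Product using (Σ; ∃; _×_; _,_; proj₁; proj₂; Σ-syntax; ∃-syntax)
open import Data.Sum using (_⊎_)
open import Data.Unit using (⊤)
open import Relation.Nullary using (¬_)
open import Relation.Nullary.Decidable using (⌊_⌋)
open import Relation.Binary.PropositionalEquality using (_≡_; _≢_)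
open import Function using (_⇔_)

record Graph : Set where
  field
    nv       : ℕ
    ne       : ℕ
    ends     : Fin ne → Fin nv × Fin nv
    loopless : ∀ f → proj₁ (ends f) ≢ proj₂ (ends f)

open Graph public

V : Graph → Set
V G = Fin (nv G)

E : Graph → Set
E G = Fin (ne G)

end₁ end₂ : (G : Graph) → E G → V G
end₁ G f = proj₁ (ends G f)
end₂ G f = proj₂ (ends G f)

Joins : (G : Graph) → E G → V G → V G → Set
Joins G f x y = (ends G f ≡ (x , y)) ⊎ (ends G f ≡ (y , x))

Adjacent : (G : Graph) → V G → V G → Set
Adjacent G x y = ∃[ f ] Joins G f x y

Inc : (G : Graph) → E G → V G → Set
Inc G f x = (end₁ G f ≡ x) ⊎ (end₂ G f ≡ x)

degree : (G : Graph) → V G → ℕ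
degree G x = sum (map (λ f → if ⌊ end₁ G f ≟ x ⌋ ∨ ⌊ end₂ G f ≟ x ⌋ then 1 else 0)
                      (allFin (ne G)))

MinDegreeAtLeast : ℕ → Graph → Set
MinDegreeAtLeast k G = ∀ x → k ≤ degree G x

-- M (a set of edges, as a Bool predicate) is a perfect matching of the
-- subgraph of G induced by the vertices satisfying `keep`.
IsPerfectMatchingOn : (G : Graph) → (V G → Set) → (E G → Bool) → Set
IsPerfectMatchingOn G keep M =
  (∀ f → M f ≡ true → keep (end₁ G f) × keep (end₂ G f)) ×
  (∀ x → keep x → Σ[ f ∈ E G ] (M f ≡ true × Inc G f x ×
                     (∀ f' → M f' ≡ true → Inc G f' x → f' ≡ f)))

IsPerfectMatching : (G : Graph) → (E G → Bool) → Set
IsPerfectMatching G M = IsPerfectMatchingOn G (λ _ → ⊤) M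

-- Reachability in G - B (walks avoiding the vertex set B).
data Reach (G : Graph) (B : Subset (nv G)) : V G → V G → Set where
  here : ∀ {x} → x ∉ B → Reach G B x x
  step : ∀ {x y z} → Reach G B x y → (f : E G) → Joins G f y z → z ∉ B →
         Reach G B x z

∅ : (n : ℕ) → Subset n
∅ n = emptySet

Connected : Graph → Set
Connected G = ∀ x y → Reach G (∅ (nv G)) x y

IsMatchingCovered : Graph → Set
IsMatchingCovered G =
  2 ≤ nv G × Connected G ×
  (∀ f → ∃[ M ] (IsPerfectMatching G M × M f ≡ true))

Odd : ℕ → Set
Odd n = ∃[ k ] n ≡ suc (2 * k)

-- the component of G - B containing x (x ∉ B) has an odd number of vertices:
-- there is a duplicate-free list enumerating exactly that component, of odd length.
OddComponentOf : (G : Graph) → Subset (nv G) → V G → Set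
OddComponentOf G B x =
  x ∉ B × ∃[ C ] (Unique C × (∀ y → (y LM.∈ C) ⇔ Reach G B x y) × Odd (length C))

-- number of odd components of G - B equals n: there is a duplicate-free list
-- R of representatives, one for each odd component of G - B.
NumOddComponents : (G : Graph) → Subset (nv G) → ℕ → Set
NumOddComponents G B n =
  ∃[ R ] (Unique R × length R ≡ n ×
          (∀ x → x LM.∈ R → OddComponentOf G B x) ×
          (∀ x → OddComponentOf G B x → ∃[ r ] (r LM.∈ R × Reach G B x r)) ×
          (∀ r r' → r LM.∈ R → r' LM.∈ R → Reach G B r r' → r ≡ r'))

IsBarrier : (G : Graph) → Subset (nv G) → Set
IsBarrier G B = NumOddComponents G B ∣ B ∣

-- A subgraph H of G that is a bisubdivision of J, given by its embedding data:
-- branch map φ (vertex x of J ↦ branch vertex φ x of H), and for each edge e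
-- of J a path of G with 2·len e internal vertices (2·len e + 1 edges)
-- from φ(end₁ e) to φ(end₂ e); the paths are internally disjoint, avoid the
-- branch vertices internally, and use pairwise distinct edges of G.
-- H is the union of the branch vertices and these paths.
record Bisubdivision (J G : Graph) : Set where
  field
    φ      : V J → V G
    φ-inj  : ∀ x y → φ x ≡ φ y → x ≡ y
    len    : E J → ℕ
  plen : E J → ℕ
  plen e = suc (2 * len e)
  Internal : (e : E J) → Fin (suc (plen e)) → Set
  Internal e i = (i ≢ zero) × (i ≢ fromℕ (plen e))
  field
    pv      : (e : E J) → Fin (suc (plen e)) → V G
    pe      : (e : E J) → Fin (plen e) → E G
    pv-start : ∀ e → pv e zero ≡ φ (end₁ J e)
    pv-end   : ∀ e → pv e (fromℕ (plen e)) ≡ φ (end₂ J e)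
    pe-joins : ∀ e i → Joins G (pe e i) (pv e (inject₁ i)) (pv e (suc i))
    pv-inj   : ∀ e i j → pv e i ≡ pv e j → i ≡ j
    pv-avoid : ∀ e i x → Internal e i → pv e i ≢ φ x
    pv-disj  : ∀ e e' i j → Internal e i → Internal e' j → pv e i ≡ pv e' j → e ≡ e'
    pe-disj  : ∀ e e' i j → pe e i ≡ pe e' j → e ≡ e'

  InH : V G → Set
  InH w = (∃[ x ] φ x ≡ w) ⊎ (∃[ e ] ∃[ i ] pv e i ≡ w)

open Bisubdivision public

IsConformal : {J G : Graph} → Bisubdivision J G → Set
IsConformal {J} {G} H = ∃[ M ] IsPerfectMatchingOn G (λ w → ¬ InH H w) M

{-# OPTIONS --safe #-}
module Submission where

-- Let e join u and v, and let P be the segment of H replacing e: a path of odd length from φ u to φ v.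
-- A perfect matching N of J lifts to one of G: keep a perfect matching of G − V(H) and, on each segment,
-- take the edges at even positions if its edge of J is in N and those at odd positions otherwise.
-- In a perfect matching of G the |B| odd components of G − B are matched into B by |B| distinct vertices,
-- so no component of G − B sends two matching edges into B. Consequently:
--  * P alternates between the lifts of a matching containing e and one avoiding e, so between two
--    consecutive vertices of B on P the distance is even: all vertices of B on P have positions of equal parity;
--  * P leaves the component K of φ u after an even number of steps, for otherwise its exit edge and the exit
--    edge of the segment of a second edge f₁ at u would lie in the lift of a matching through f₁ or through
--    a third edge f₂ at u (this is where δ(J) ≥ 3 is used).
-- So the first vertex of B seen from φ u is at an odd position and, P having odd length, the first one seen
-- from φ v is at an even position, a contradiction.

open import Defs
open import Data.Bool using (Bool; true; false; _∨_; if_then_else_; T)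
import Data.Bool.Properties as Boolₚ
open import Data.Empty using (⊥-elim)
open import Data.Fin as Fin using (Fin; zero; suc; toℕ; inject₁; fromℕ)
import Data.Fin.Properties as Finₚ
open import Data.Fin.Subset using (Subset; _∈_; _∉_; ∣_∣)
import Data.Fin.Subset.Properties as Subsetₚ
open import Data.List using (List; []; _∷_; length; map; filter; filterᵇ; allFin; tabulate; lookup)
import Data.List.Properties as Listₚ
open import Data.List.Membership.Propositional as Mem using () renaming (_∈_ to _∈ˡ_; _∉_ to _∉ˡ_)
import Data.List.Membership.DecPropositional as DecMem
open import Data.List.Membership.Propositional.Properties using (∈-filter⁺; ∈-filter⁻; ∈-map⁻; ∈-tabulate⁻; ∈-lookup)
open import Data.List.Relation.Unary.All as All using (All; []; _∷_)
open import Data.List.Relation.Unary.Any as Any using (here; there)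
open import Data.List.Relation.Unary.AllPairs using ([]; _∷_)
open import Data.List.Relation.Unary.Unique.Propositional using (Unique)
import Data.List.Relation.Unary.Unique.Propositional.Properties as Uniqueₚ
open import Data.Nat as ℕ using (ℕ; zero; suc; _+_; _*_; _∸_; _≤_; _<_; z≤n; s≤s; parity)
open import Data.Nat.Induction using (<-wellFounded)
open import Data.Nat.ListAction using (sum)
import Data.Nat.Properties as ℕₚ
open import Data.Parity as ℙ using (Parity; 0ℙ; 1ℙ; _⁻¹)
import Data.Parity.Properties as ℙₚ
open import Data.Product using (∃-syntax; _×_; _,_; proj₁; proj₂)
open import Data.Sum as Sum using (_⊎_; inj₁; inj₂; [_,_])
open import Data.Unit using (tt)
open import Function using (_∘_; case_of_; Equivalence)
open import Induction.WellFounded using (Acc; acc)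
open import Level using (0ℓ)
open import Relation.Binary.Definitions using (DecidableEquality)
open import Relation.Binary.PropositionalEquality
  using (_≡_; _≢_; refl; sym; trans; cong; cong₂; subst; module ≡-Reasoning)
open import Relation.Nullary using (¬_; yes; no; does; contradiction)
open import Relation.Nullary.Decidable using (⌊_⌋; ¬?; T?; _⊎-dec_; _×-dec_; dec-true)
open import Relation.Unary using (Pred; Decidable)

-- Counting in finite lists

module _ {A : Set} (_≟_ : DecidableEquality A) where

  unique-⊆-length≤ : ∀ {xs ys : List A} → Unique xs → All (_∈ˡ ys) xs → length xs ≤ length ys
  unique-⊆-length≤ [] [] = z≤n
  unique-⊆-length≤ {x ∷ xs} {ys} (x∉xs ∷ xs!) (x∈ys ∷ xs⊆ys) = ℕₚ.≤-<-trans
    (unique-⊆-length≤ xs! (All.zipWith (λ (y≢x , y∈ys) → ∈-filter⁺ (¬? ∘ (_≟ x)) y∈ys y≢x)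
                                        (All.map (λ x≢y → x≢y ∘ sym) x∉xs , xs⊆ys)))
    (Listₚ.filter-notAll (¬? ∘ (_≟ x)) ys (Any.map (λ x≡y y≢x → y≢x (sym x≡y)) x∈ys))

length-filter+length-filter-¬ : ∀ {A : Set} {P : Pred A 0ℓ} (P? : Decidable P) xs →
  length (filter P? xs) + length (filter (¬? ∘ P?) xs) ≡ length xs
length-filter+length-filter-¬ P? [] = refl
length-filter+length-filter-¬ P? (x ∷ xs) with P? x
... | yes _ = cong suc (length-filter+length-filter-¬ P? xs)
... | no _ = trans (ℕₚ.+-suc _ _) (cong suc (length-filter+length-filter-¬ P? xs))

module _ {n} (p : Fin n → Fin n) (p-involutive : ∀ x → p (p x) ≡ x) (p-fixfree : ∀ x → p x ≢ x) where

  private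
    ascends? : Decidable (λ x → x Fin.< p x)
    ascends? x = x Finₚ.<? p x

    p-injective : ∀ {x y} → p x ≡ p y → x ≡ y
    p-injective {x} {y} px≡py = trans (sym (p-involutive x)) (trans (cong p px≡py) (p-involutive y))

  -- p pairs the elements below their image with those above it.
  involution-closed-length-even : ∀ {xs} → Unique xs → All (λ x → p x ∈ˡ xs) xs → parity (length xs) ≡ 0ℙ
  involution-closed-length-even {xs} xs! closed = begin
    parity (length xs)                          ≡⟨ cong parity (sym (length-filter+length-filter-¬ ascends? xs)) ⟩
    parity (length lo + length hi)              ≡⟨ cong (λ m → parity (length lo + m)) (sym lo≡hi) ⟩
    parity (length lo + length lo)              ≡⟨ ℙₚ.+-homo-+ (length lo) (length lo) ⟩
    parity (length lo) ℙ.+ parity (length lo)   ≡⟨ ℙₚ.p+p≡0ℙ (parity (length lo)) ⟩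
    0ℙ                                          ∎
    where
    open ≡-Reasoning
    lo = filter ascends? xs
    hi = filter (¬? ∘ ascends?) xs

    p-closed : ∀ {x} → x ∈ˡ xs → p x ∈ˡ xs
    p-closed = All.lookup closed

    length≤-via-p : ∀ {ys zs} → Unique ys → All (_∈ˡ zs) (map p ys) → length ys ≤ length zs
    length≤-via-p {ys} ys! ⊆zs =
      subst (_≤ _) (Listₚ.length-map p ys) (unique-⊆-length≤ Finₚ._≟_ (Uniqueₚ.map⁺ p-injective ys!) ⊆zs)

    lo↦hi : All (_∈ˡ hi) (map p lo)
    lo↦hi = All.tabulate λ y∈ → case ∈-map⁻ p y∈ of λ where
      (x , x∈lo , refl) → let x∈xs , x<px = ∈-filter⁻ ascends? x∈lo in
        ∈-filter⁺ (¬? ∘ ascends?) (p-closed x∈xs)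
          (λ px<ppx → Finₚ.<-asym x<px (subst (p x Fin.<_) (p-involutive x) px<ppx))

    hi↦lo : All (_∈ˡ lo) (map p hi)
    hi↦lo = All.tabulate λ y∈ → case ∈-map⁻ p y∈ of λ where
      (x , x∈hi , refl) → let x∈xs , x≮px = ∈-filter⁻ (¬? ∘ ascends?) x∈hi in
        ∈-filter⁺ ascends? (p-closed x∈xs)
          (subst (p x Fin.<_) (sym (p-involutive x)) (Finₚ.≤∧≢⇒< (ℕₚ.≮⇒≥ x≮px) (p-fixfree x)))

    lo≡hi : length lo ≡ length hi
    lo≡hi = ℕₚ.≤-antisym (length≤-via-p (Uniqueₚ.filter⁺ ascends? xs!) lo↦hi)
                         (length≤-via-p (Uniqueₚ.filter⁺ (¬? ∘ ascends?) xs!) hi↦lo)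

unique-⊆-length≤∣∣ : ∀ {n} {p : Subset n} {xs} → Unique xs → All (_∈ p) xs → length xs ≤ ∣ p ∣
unique-⊆-length≤∣∣ [] [] = z≤n
unique-⊆-length≤∣∣ (x∉xs ∷ xs!) (x∈p ∷ xs⊆p) = ℕₚ.≤-<-trans
  (unique-⊆-length≤∣∣ xs! (All.zipWith (λ (x≢y , y∈p) → Subsetₚ.x∈p∧x≢y⇒x∈p-y y∈p (x≢y ∘ sym)) (x∉xs , xs⊆p)))
  (Subsetₚ.p⊂q⇒∣p∣<∣q∣ (Subsetₚ.x∈p⇒p-x⊂p x∈p))

unique-⊆-length≡∣∣⇒⊇ : ∀ {n} {p : Subset n} {xs} → Unique xs → All (_∈ p) xs → length xs ≡ ∣ p ∣ →
                        ∀ {x} → x ∈ p → x ∈ˡ xs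
unique-⊆-length≡∣∣⇒⊇ {xs = xs} xs! xs⊆p |xs|≡|p| {x} x∈p with DecMem._∈?_ Finₚ._≟_ x xs
... | yes x∈xs = x∈xs
... | no x∉xs = contradiction
  (unique-⊆-length≤∣∣ (All.tabulate (λ y∈xs x≡y → x∉xs (subst (_∈ˡ xs) (sym x≡y) y∈xs)) ∷ xs!) (x∈p ∷ xs⊆p))
  (ℕₚ.<-irrefl |xs|≡|p|)

lookup-injective : ∀ {A : Set} {xs : List A} → Unique xs → ∀ i j → lookup xs i ≡ lookup xs j → i ≡ j
lookup-injective (_ ∷ _) zero zero _ = refl
lookup-injective (x≢xs ∷ _) zero (suc j) eq = contradiction eq (All.lookup x≢xs (∈-lookup j))
lookup-injective (x≢xs ∷ _) (suc i) zero eq = contradiction (sym eq) (All.lookup x≢xs (∈-lookup i))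
lookup-injective (_ ∷ xs!) (suc i) (suc j) eq = cong suc (lookup-injective xs! i j eq)

sum-indicator≡length-filterᵇ : ∀ {A : Set} (b : A → Bool) xs →
  sum (map (λ x → if b x then 1 else 0) xs) ≡ length (filterᵇ b xs)
sum-indicator≡length-filterᵇ b [] = refl
sum-indicator≡length-filterᵇ b (x ∷ xs) with b x
... | true = cong suc (sum-indicator≡length-filterᵇ b xs)
... | false = sum-indicator≡length-filterᵇ b xs

-- Parity

parity-suc : ∀ n → parity (suc n) ≡ parity n ⁻¹
parity-suc n = sym (ℙₚ.⁻¹-selfInverse (ℙₚ.suc-homo-⁻¹ n))

parity-double : ∀ n → parity (2 * n) ≡ 0ℙ
parity-double n = ℙₚ.*-homo-* 2 n

parity-∸ : ∀ {m n} → n ≤ m → parity (m ∸ n) ≡ parity m ℙ.+ parity n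
parity-∸ {m} {n} n≤m = begin
  parity (m ∸ n)                                ≡⟨ sym (ℙₚ.+-identityʳ _) ⟩
  parity (m ∸ n) ℙ.+ 0ℙ                         ≡⟨ cong (parity (m ∸ n) ℙ.+_) (sym (ℙₚ.p+p≡0ℙ (parity n))) ⟩
  parity (m ∸ n) ℙ.+ (parity n ℙ.+ parity n)    ≡⟨ sym (ℙₚ.+-assoc (parity (m ∸ n)) _ _) ⟩
  parity (m ∸ n) ℙ.+ parity n ℙ.+ parity n      ≡⟨ cong (ℙ._+ parity n) (sym (ℙₚ.+-homo-+ (m ∸ n) n)) ⟩
  parity (m ∸ n + n) ℙ.+ parity n               ≡⟨ cong (λ k → parity k ℙ.+ parity n) (ℕₚ.m∸n+n≡m n≤m) ⟩
  parity m ℙ.+ parity n                         ∎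
  where open ≡-Reasoning

p≢q⇒p≡q⁻¹ : ∀ {p q : Parity} → p ≢ q → p ≡ q ⁻¹
p≢q⇒p≡q⁻¹ {0ℙ} {0ℙ} p≢q = contradiction refl p≢q
p≢q⇒p≡q⁻¹ {0ℙ} {1ℙ} _ = refl
p≢q⇒p≡q⁻¹ {1ℙ} {0ℙ} _ = refl
p≢q⇒p≡q⁻¹ {1ℙ} {1ℙ} p≢q = contradiction refl p≢q

parity[k]≢q⇒parity[1+k]≡q : ∀ {k q} → parity k ≢ q → parity (suc k) ≡ q
parity[k]≢q⇒parity[1+k]≡q {k} pk≢q = trans (parity-suc k) (trans (cong _⁻¹ (p≢q⇒p≡q⁻¹ pk≢q)) (ℙₚ.⁻¹-selfInverse refl))

parity[1+k]≢q⇒parity[k]≡q : ∀ {k q} → parity (suc k) ≢ q → parity k ≡ q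
parity[1+k]≢q⇒parity[k]≡q {k} pk+1≢q = ℙₚ.⁻¹-injective (trans (sym (parity-suc k)) (p≢q⇒p≡q⁻¹ pk+1≢q))

-- Graphs and perfect matchings

module GraphProperties (G : Graph) where

  joins-sym : ∀ {f x y} → Joins G f x y → Joins G f y x
  joins-sym (inj₁ eq) = inj₂ eq
  joins-sym (inj₂ eq) = inj₁ eq

  joins⇒inc : ∀ {f x y} → Joins G f x y → Inc G f x
  joins⇒inc (inj₁ eq) = inj₁ (cong proj₁ eq)
  joins⇒inc (inj₂ eq) = inj₂ (cong proj₂ eq)

  inc⇒joins : ∀ {f x} → Inc G f x → ∃[ y ] Joins G f x y
  inc⇒joins (inj₁ refl) = _ , inj₁ refl
  inc⇒joins (inj₂ refl) = _ , inj₂ refl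

  joins⇒≢ : ∀ {f x y} → Joins G f x y → x ≢ y
  joins⇒≢ {f} (inj₁ refl) = loopless G f
  joins⇒≢ {f} (inj₂ refl) = loopless G f ∘ sym

  joins-ends : ∀ {f x y z} → Joins G f x y → Inc G f z → z ≡ x ⊎ z ≡ y
  joins-ends (inj₁ refl) (inj₁ refl) = inj₁ refl
  joins-ends (inj₁ refl) (inj₂ refl) = inj₂ refl
  joins-ends (inj₂ refl) (inj₁ refl) = inj₂ refl
  joins-ends (inj₂ refl) (inj₂ refl) = inj₁ refl

  joins-same-edge : ∀ {f a b c d} → Joins G f a b → Joins G f c d → (a ≡ c × b ≡ d) ⊎ (a ≡ d × b ≡ c)
  joins-same-edge (inj₁ refl) (inj₁ refl) = inj₁ (refl , refl)
  joins-same-edge (inj₁ refl) (inj₂ refl) = inj₂ (refl , refl)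
  joins-same-edge (inj₂ refl) (inj₁ refl) = inj₂ (refl , refl)
  joins-same-edge (inj₂ refl) (inj₂ refl) = inj₁ (refl , refl)

  joins-other-end : ∀ {f x y z} → Joins G f x y → Joins G f x z → y ≡ z
  joins-other-end f∶xy f∶xz with joins-same-edge f∶xy f∶xz
  ... | inj₁ (_ , y≡z) = y≡z
  ... | inj₂ (x≡z , y≡x) = contradiction (sym y≡x) (joins⇒≢ f∶xy)

  module _ {B : Subset (nv G)} where

    reach-∉ : ∀ {x y} → Reach G B x y → y ∉ B
    reach-∉ (here y∉B) = y∉B
    reach-∉ (step _ _ _ y∉B) = y∉B

    reach-trans : ∀ {x y z} → Reach G B x y → Reach G B y z → Reach G B x z
    reach-trans r (here _) = r
    reach-trans r (step r′ f f∶ z∉B) = step (reach-trans r r′) f f∶ z∉B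

    reach-sym : ∀ {x y} → Reach G B x y → Reach G B y x
    reach-sym (here x∉B) = here x∉B
    reach-sym (step r f f∶yz z∉B) = reach-trans (step (here z∉B) f (joins-sym f∶yz) (reach-∉ r)) (reach-sym r)

matching-edge-unique : ∀ {G keep M x f g} → IsPerfectMatchingOn G keep M → keep x →
  M f ≡ true → M g ≡ true → Inc G f x → Inc G g x → f ≡ g
matching-edge-unique (_ , cover) kx Mf Mg f∋x g∋x =
  let _ , _ , _ , unique = cover _ kx in trans (unique _ Mf f∋x) (sym (unique _ Mg g∋x))

module Mate {G : Graph} {M : E G → Bool} (M-perfect : IsPerfectMatching G M) where
  open GraphProperties G

  mateEdge : V G → E G
  mateEdge x = proj₁ (proj₂ M-perfect x tt)

  mateEdge-∈ : ∀ x → M (mateEdge x) ≡ true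
  mateEdge-∈ x = proj₁ (proj₂ (proj₂ M-perfect x tt))

  mate : V G → V G
  mate x = proj₁ (inc⇒joins (proj₁ (proj₂ (proj₂ (proj₂ M-perfect x tt)))))

  mate-joins : ∀ x → Joins G (mateEdge x) x (mate x)
  mate-joins x = proj₂ (inc⇒joins (proj₁ (proj₂ (proj₂ (proj₂ M-perfect x tt)))))

  matched-edge-unique : ∀ {f g x} → M f ≡ true → M g ≡ true → Inc G f x → Inc G g x → f ≡ g
  matched-edge-unique = matching-edge-unique {G} {M = M} M-perfect tt

  mate-unique : ∀ {f x y} → M f ≡ true → Joins G f x y → mate x ≡ y
  mate-unique {f} {x} Mf f∶xy = joins-other-end (mate-joins x) (subst (λ g → Joins G g x _) f≡mateEdge f∶xy)
    where f≡mateEdge = matched-edge-unique Mf (mateEdge-∈ x) (joins⇒inc f∶xy) (joins⇒inc (mate-joins x))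

  mate-involutive : ∀ x → mate (mate x) ≡ x
  mate-involutive x = mate-unique (mateEdge-∈ x) (joins-sym (mate-joins x))

  mate-fixfree : ∀ x → mate x ≢ x
  mate-fixfree x = joins⇒≢ (mate-joins x) ∘ sym

incident? : (G : Graph) (x : V G) → Decidable (λ f → Inc G f x)
incident? G x f = (end₁ G f Finₚ.≟ x) ⊎-dec (end₂ G f Finₚ.≟ x)

degree≤ : ∀ (G : Graph) {x es} → (∀ f → Inc G f x → f ∈ˡ es) → degree G x ≤ length es
degree≤ G {x} es⊇ = subst (_≤ _) (sym (sum-indicator≡length-filterᵇ incidentᵇ (allFin (ne G))))
  (unique-⊆-length≤ Finₚ._≟_ (Uniqueₚ.filter⁺ (T? ∘ incidentᵇ) {allFin (ne G)} (Uniqueₚ.allFin⁺ (ne G)))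
    (All.tabulate λ f∈ → es⊇ _ (T-incident _ (proj₂ (∈-filter⁻ (T? ∘ incidentᵇ) {xs = allFin (ne G)} f∈)))))
  where
  incidentᵇ : E G → Bool
  incidentᵇ f = ⌊ end₁ G f Finₚ.≟ x ⌋ ∨ ⌊ end₂ G f Finₚ.≟ x ⌋

  T-incident : ∀ f → T (incidentᵇ f) → Inc G f x
  T-incident f _ with end₁ G f Finₚ.≟ x | end₂ G f Finₚ.≟ x
  ... | yes f₁≡x | _ = inj₁ f₁≡x
  ... | no _ | yes f₂≡x = inj₂ f₂≡x

incident-edge-∉ : ∀ (G : Graph) {x} es → length es < degree G x → ∃[ f ] Inc G f x × f ∉ˡ es
incident-edge-∉ G {x} es |es|<deg
  with Finₚ.any? (λ f → incident? G x f ×-dec ¬? (DecMem._∈?_ Finₚ._≟_ f es))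
... | yes (f , f∋x , f∉es) = f , f∋x , f∉es
... | no ∄f = contradiction (degree≤ G es⊇) (ℕₚ.<⇒≱ |es|<deg)
  where
  es⊇ : ∀ f → Inc G f x → f ∈ˡ es
  es⊇ f f∋x with DecMem._∈?_ Finₚ._≟_ f es
  ... | yes f∈es = f∈es
  ... | no f∉es = contradiction (f , f∋x , f∉es) ∄f

-- Barriers

parity-odd : ∀ {n} → Odd n → parity n ≡ 1ℙ
parity-odd (k , refl) = trans (parity-suc (2 * k)) (cong _⁻¹ (parity-double k))

module Barrier {G : Graph} {B : Subset (nv G)} (B-barrier : IsBarrier G B)
               {M : E G → Bool} (M-perfect : IsPerfectMatching G M) where
  open GraphProperties G
  open Mate {G} {M} M-perfect

  odd-component-exit : ∀ {r} → OddComponentOf G B r → ∃[ y ] Reach G B r y × mate y ∈ B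
  odd-component-exit {r} (_ , C , C! , C≡comp , C-odd) with Any.any? (λ y → mate y Subsetₚ.∈? B) C
  ... | yes exits = let y , y∈C , my∈B = Mem.find exits in y , Equivalence.to (C≡comp y) y∈C , my∈B
  ... | no ∄exit = contradiction
    (trans (sym (parity-odd C-odd)) (involution-closed-length-even mate mate-involutive mate-fixfree C! mate-closed))
    λ ()
    where
    mate-closed : All (λ y → mate y ∈ˡ C) C
    mate-closed = All.tabulate λ {y} y∈C → Equivalence.from (C≡comp (mate y))
      (step (Equivalence.to (C≡comp y) y∈C) (mateEdge y) (mate-joins y) (∄exit ∘ Mem.lose y∈C))

  private
    R = proj₁ B-barrier
    R! = proj₁ (proj₂ B-barrier)
    |R|≡|B| = proj₁ (proj₂ (proj₂ B-barrier))
    R-odd = proj₁ (proj₂ (proj₂ (proj₂ B-barrier)))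
    R-separated = proj₂ (proj₂ (proj₂ (proj₂ (proj₂ B-barrier))))

    rep : Fin (length R) → V G
    rep = lookup R

    exit-of : ∀ i → ∃[ y ] Reach G B (rep i) y × mate y ∈ B
    exit-of i = odd-component-exit (R-odd (rep i) (∈-lookup i))

    barrierMate : Fin (length R) → V G
    barrierMate i = mate (proj₁ (exit-of i))

    barrierMate-∈ : ∀ i → barrierMate i ∈ B
    barrierMate-∈ i = proj₂ (proj₂ (exit-of i))

    reach-mate-barrierMate : ∀ i → Reach G B (rep i) (mate (barrierMate i))
    reach-mate-barrierMate i = subst (Reach G B (rep i)) (sym (mate-involutive _)) (proj₁ (proj₂ (exit-of i)))

    rep-separated : ∀ {i j x} → Reach G B (rep i) x → Reach G B (rep j) x → i ≡ j
    rep-separated {i} {j} ri rj =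
      lookup-injective R! i j (R-separated _ _ (∈-lookup i) (∈-lookup j) (reach-trans ri (reach-sym rj)))

    barrierMate-injective : ∀ {i j} → barrierMate i ≡ barrierMate j → i ≡ j
    barrierMate-injective {i} {j} eq = rep-separated (reach-mate-barrierMate i)
      (subst (λ b → Reach G B (rep j) (mate b)) (sym eq) (reach-mate-barrierMate j))

    -- The odd components number |B| and each sends a matching edge into B, so these edges exhaust B.
    barrier-vertex-matched-into-component : ∀ {b} → b ∈ B → ∃[ i ] b ≡ barrierMate i
    barrier-vertex-matched-into-component b∈B = ∈-tabulate⁻ (unique-⊆-length≡∣∣⇒⊇
      (Uniqueₚ.tabulate⁺ barrierMate-injective)
      (All.tabulate (λ b∈ → case ∈-tabulate⁻ b∈ of λ where (i , refl) → barrierMate-∈ i))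
      (trans (Listₚ.length-tabulate barrierMate) |R|≡|B|) b∈B)

    matched-into-component : ∀ {h b x} → M h ≡ true → Joins G h x b → b ∈ B →
                             ∃[ i ] b ≡ barrierMate i × Reach G B (rep i) x
    matched-into-component Mh h∶xb b∈B with barrier-vertex-matched-into-component b∈B
    ... | i , refl = i , refl , subst (Reach G B (rep i)) (mate-unique Mh (joins-sym h∶xb)) (reach-mate-barrierMate i)

  matched-leaves-barrier : ∀ {h b b′} → M h ≡ true → Joins G h b b′ → b ∈ B → b′ ∉ B
  matched-leaves-barrier Mh h∶bb′ b∈B = reach-∉ (proj₂ (proj₂ (matched-into-component Mh (joins-sym h∶bb′) b∈B)))

  matched-once-into-barrier : ∀ {h₁ h₂ x₁ x₂ b₁ b₂} → M h₁ ≡ true → M h₂ ≡ true →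
    Joins G h₁ x₁ b₁ → Joins G h₂ x₂ b₂ → Reach G B x₁ x₂ → b₁ ∈ B → b₂ ∈ B → h₁ ≡ h₂
  matched-once-into-barrier Mh₁ Mh₂ h₁∶x₁b₁ h₂∶x₂b₂ x₁~x₂ b₁∈B b₂∈B
    with matched-into-component Mh₁ h₁∶x₁b₁ b₁∈B | matched-into-component Mh₂ h₂∶x₂b₂ b₂∈B
  ... | i , refl , rᵢ | j , refl , rⱼ with rep-separated rᵢ (reach-trans rⱼ (reach-sym x₁~x₂))
  ... | refl = matched-edge-unique Mh₁ Mh₂ (joins⇒inc (joins-sym h₁∶x₁b₁)) (joins⇒inc (joins-sym h₂∶x₂b₂))

no-edge-inside-barrier : ∀ {G B h b b′} → IsMatchingCovered G → IsBarrier G B → Joins G h b b′ → b ∈ B → b′ ∉ B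
no-edge-inside-barrier {h = h} (_ , _ , covered) B-barrier h∶bb′ =
  let M , M-perfect , Mh = covered h in Barrier.matched-leaves-barrier B-barrier M-perfect Mh h∶bb′

-- Paths

-- Positions are natural numbers; only the vertices at positions ≤ size and the edges at positions < size
-- belong to the path.
record Path (G : Graph) : Set where
  field
    size           : ℕ
    vert           : ℕ → V G
    edge           : ℕ → E G
    joins          : ∀ k → k < size → Joins G (edge k) (vert k) (vert (suc k))
    vert-injective : ∀ i j → i ≤ size → j ≤ size → vert i ≡ vert j → i ≡ j

reverse : ∀ {G} → Path G → Path G
reverse {G} P = record
  { size           = size
  ; vert           = λ k → vert (size ∸ k)
  ; edge           = λ k → edge (size ∸ suc k)
  ; joins          = λ k k<size → subst (λ v → Joins G (edge (size ∸ suc k)) v (vert (size ∸ suc k)))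
                       (cong vert (sym (ℕₚ.+-∸-assoc 1 k<size)))
                       (GraphProperties.joins-sym G (joins (size ∸ suc k) (ℕₚ.∸-monoʳ-< (s≤s z≤n) k<size)))
  ; vert-injective = λ i j i≤size j≤size eq → trans (sym (ℕₚ.m∸[m∸n]≡n i≤size))
                       (trans (cong (size ∸_) (vert-injective _ _ (ℕₚ.m∸n≤m size i) (ℕₚ.m∸n≤m size j) eq))
                              (ℕₚ.m∸[m∸n]≡n j≤size))
  }
  where open Path P

module PathProperties {G : Graph} (P : Path G) where
  open Path P
  open GraphProperties G

  edge-injective : ∀ i j → i < size → j < size → edge i ≡ edge j → i ≡ j
  edge-injective i j i<size j<size eq
    with joins-same-edge (joins i i<size) (subst (λ f → Joins G f _ _) (sym eq) (joins j j<size))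
  ... | inj₁ (vᵢ≡vⱼ , _) = vert-injective i j (ℕₚ.<⇒≤ i<size) (ℕₚ.<⇒≤ j<size) vᵢ≡vⱼ
  ... | inj₂ (vᵢ≡vⱼ₊₁ , vᵢ₊₁≡vⱼ) = contradiction
    (trans (vert-injective i (suc j) (ℕₚ.<⇒≤ i<size) j<size vᵢ≡vⱼ₊₁)
           (cong suc (sym (vert-injective (suc i) j i<size (ℕₚ.<⇒≤ j<size) vᵢ₊₁≡vⱼ))))
    (ℕₚ.<⇒≢ (ℕₚ.m<n+m i {2} (s≤s z≤n)))

  module _ {B : Subset (nv G)} where

    exit : ∀ {s k j} → k ≤ j → j ≤ size → Reach G B s (vert k) → ¬ Reach G B s (vert j) →
           ∃[ a ] k ≤ a × a < j × Reach G B s (vert a) × vert (suc a) ∈ B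
    exit {s} {j = j} k≤j j≤size = go (ℕₚ.≤⇒≤‴ k≤j)
      where
      go : ∀ {k} → k ℕ.≤‴ j → Reach G B s (vert k) → ¬ Reach G B s (vert j) →
           ∃[ a ] k ≤ a × a < j × Reach G B s (vert a) × vert (suc a) ∈ B
      go ℕ.≤‴-refl reach ¬reach = contradiction reach ¬reach
      go {k = k} (ℕ.≤‴-step k<j) reach ¬reach with vert (suc k) Subsetₚ.∈? B
      ... | yes ∈B = k , ℕₚ.≤-refl , ℕₚ.≤‴⇒≤ k<j , reach , ∈B
      ... | no ∉B =
        let a , k<a , rest = go k<j (step reach (edge k) (joins k (ℕₚ.<-≤-trans (ℕₚ.≤‴⇒≤ k<j) j≤size)) ∉B) ¬reach
        in  a , ℕₚ.<⇒≤ k<a , rest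

module _ {G : Graph} {B : Subset (nv G)} (G-covered : IsMatchingCovered G) (B-barrier : IsBarrier G B)
         (P : Path G) (M : Parity → E G → Bool) (M-perfect : ∀ p → IsPerfectMatching G (M p))
         (alternating : ∀ k → k < Path.size P → M (parity k) (Path.edge P k) ≡ true) where
  open Path P
  open PathProperties P
  open GraphProperties G

  private
    -- Edges i and a both leave the component of vert (suc i) into B, so they lie in different matchings.
    segment-parity : ∀ {i a} → i < a → a < size → vert i ∈ B → Reach G B (vert (suc i)) (vert a) →
                     vert (suc a) ∈ B → parity (suc a) ≡ parity i
    segment-parity {i} {a} i<a a<size vᵢ∈B vᵢ₊₁~vₐ vₐ₊₁∈B = parity[k]≢q⇒parity[1+k]≡q {a} pa≢pi
      where
      i<size = ℕₚ.<-trans i<a a<size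
      pa≢pi : parity a ≢ parity i
      pa≢pi pa≡pi = ℕₚ.<⇒≢ i<a (edge-injective i a i<size a<size
        (Barrier.matched-once-into-barrier B-barrier (M-perfect (parity i))
          (alternating i i<size) (subst (λ p → M p (edge a) ≡ true) pa≡pi (alternating a a<size))
          (joins-sym (joins i i<size)) (joins a a<size) vᵢ₊₁~vₐ vᵢ∈B vₐ₊₁∈B))

    next-barrier-position : ∀ {i j} → i < j → j ≤ size → vert i ∈ B → vert j ∈ B →
                            ∃[ m ] i < m × m ≤ j × vert m ∈ B × parity m ≡ parity i
    next-barrier-position {i} {j} i<j j≤size vᵢ∈B vⱼ∈B
      with exit i<j j≤size
             (here (no-edge-inside-barrier G-covered B-barrier (joins i (ℕₚ.<-≤-trans i<j j≤size)) vᵢ∈B))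
             (λ r → reach-∉ r vⱼ∈B)
    ... | a , i<a , a<j , vᵢ₊₁~vₐ , vₐ₊₁∈B =
      suc a , s≤s (ℕₚ.<⇒≤ i<a) , a<j , vₐ₊₁∈B , segment-parity i<a (ℕₚ.<-≤-trans a<j j≤size) vᵢ∈B vᵢ₊₁~vₐ vₐ₊₁∈B

    same-parity : ∀ {i j} → Acc ℕ._<_ (j ∸ i) → i ≤ j → j ≤ size → vert i ∈ B → vert j ∈ B → parity i ≡ parity j
    same-parity (acc smaller) i≤j j≤size vᵢ∈B vⱼ∈B with ℕₚ.m≤n⇒m<n∨m≡n i≤j
    ... | inj₂ refl = refl
    ... | inj₁ i<j =
      let m , i<m , m≤j , vₘ∈B , pm≡pi = next-barrier-position i<j j≤size vᵢ∈B vⱼ∈B in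
      trans (sym pm≡pi) (same-parity (smaller (ℕₚ.∸-monoʳ-< i<m m≤j)) m≤j j≤size vₘ∈B vⱼ∈B)

  barrier-positions-same-parity : ∀ {i j} → i ≤ size → j ≤ size → vert i ∈ B → vert j ∈ B → parity i ≡ parity j
  barrier-positions-same-parity {i} {j} i≤size j≤size vᵢ∈B vⱼ∈B with ℕₚ.≤-total i j
  ... | inj₁ i≤j = same-parity (<-wellFounded _) i≤j j≤size vᵢ∈B vⱼ∈B
  ... | inj₂ j≤i = sym (same-parity (<-wellFounded _) j≤i i≤size vⱼ∈B vᵢ∈B)

-- Bisubdivisions

clamp : (n : ℕ) → ℕ → Fin (suc n)
clamp zero    _       = zero
clamp (suc n) zero    = zero
clamp (suc n) (suc k) = suc (clamp n k)

toℕ-clamp : ∀ {n k} → k ≤ n → toℕ (clamp n k) ≡ k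
toℕ-clamp {zero}  z≤n       = refl
toℕ-clamp {suc n} z≤n       = refl
toℕ-clamp {suc n} (s≤s k≤n) = cong suc (toℕ-clamp k≤n)

clamp-toℕ : ∀ {n} (i : Fin (suc n)) → clamp n (toℕ i) ≡ i
clamp-toℕ {zero}  zero    = refl
clamp-toℕ {suc n} zero    = refl
clamp-toℕ {suc n} (suc i) = cong suc (clamp-toℕ i)

inject₁-clamp : ∀ {n k} → k ≤ n → inject₁ (clamp n k) ≡ clamp (suc n) k
inject₁-clamp {zero}  z≤n       = refl
inject₁-clamp {suc n} z≤n       = refl
inject₁-clamp {suc n} (s≤s k≤n) = cong suc (inject₁-clamp k≤n)

clamp-self : ∀ n → clamp n n ≡ fromℕ n
clamp-self n = subst (λ k → clamp n k ≡ fromℕ n) (Finₚ.toℕ-fromℕ n) (clamp-toℕ (fromℕ n))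

position-cases : ∀ {k n} → k ≤ n → k ≡ 0 ⊎ k ≡ n ⊎ (0 < k × k < n)
position-cases {zero} _ = inj₁ refl
position-cases {suc k} sk≤n with ℕₚ.m≤n⇒m<n∨m≡n sk≤n
... | inj₁ sk<n = inj₂ (inj₂ (s≤s z≤n , sk<n))
... | inj₂ sk≡n = inj₂ (inj₁ sk≡n)

module Segments {J G : Graph} (H : Bisubdivision J G) where

  segment : E J → Path G
  segment e = record
    { size           = plen H e
    ; vert           = λ k → pv H e (clamp (plen H e) k)
    ; edge           = λ k → pe H e (clamp (2 * len H e) k)
    ; joins          = λ k k<size →
        subst (λ v → Joins G (pe H e (clamp (2 * len H e) k)) v (pv H e (suc (clamp (2 * len H e) k))))
              (cong (pv H e) (inject₁-clamp (ℕₚ.≤-pred k<size))) (pe-joins H e _)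
    ; vert-injective = λ i j i≤size j≤size eq →
        trans (sym (toℕ-clamp i≤size)) (trans (cong toℕ (pv-inj H e _ _ eq)) (toℕ-clamp j≤size))
    }

  open Path

  segment-start : ∀ e → vert (segment e) 0 ≡ φ H (end₁ J e)
  segment-start e = pv-start H e

  segment-end : ∀ e → vert (segment e) (plen H e) ≡ φ H (end₂ J e)
  segment-end e = trans (cong (pv H e) (clamp-self (plen H e))) (pv-end H e)

  pe≡segment-edge : ∀ e i → pe H e i ≡ edge (segment e) (toℕ i)
  pe≡segment-edge e i = cong (pe H e) (sym (clamp-toℕ i))

  pv≡segment-vert : ∀ e j → pv H e j ≡ vert (segment e) (toℕ j)
  pv≡segment-vert e j = cong (pv H e) (sym (clamp-toℕ j))

  segment-vert-∈H : ∀ e k → InH H (vert (segment e) k)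
  segment-vert-∈H e k = inj₂ (e , clamp (plen H e) k , refl)

  segment-edges-disjoint : ∀ {e e′ k k′} → edge (segment e) k ≡ edge (segment e′) k′ → e ≡ e′
  segment-edges-disjoint = pe-disj H _ _ _ _

  private
    internal : ∀ {e k} → 0 < k → k < plen H e → Internal H e (clamp (plen H e) k)
    internal {e} 0<k k<size =
        (λ eq → ℕₚ.<⇒≢ 0<k (trans (cong toℕ (sym eq)) (toℕ-clamp (ℕₚ.<⇒≤ k<size))))
      , (λ eq → ℕₚ.<⇒≢ k<size (trans (sym (toℕ-clamp (ℕₚ.<⇒≤ k<size))) (trans (cong toℕ eq) (Finₚ.toℕ-fromℕ _))))

  segment-branch : ∀ {e k y} → k ≤ plen H e → vert (segment e) k ≡ φ H y →
                   (k ≡ 0 × end₁ J e ≡ y) ⊎ (k ≡ plen H e × end₂ J e ≡ y)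
  segment-branch {e} {k} {y} k≤size eq with position-cases k≤size
  ... | inj₁ refl = inj₁ (refl , φ-inj H _ _ (trans (sym (segment-start e)) eq))
  ... | inj₂ (inj₁ refl) = inj₂ (refl , φ-inj H _ _ (trans (sym (segment-end e)) eq))
  ... | inj₂ (inj₂ (0<k , k<size)) = contradiction eq (pv-avoid H e _ y (internal 0<k k<size))

  segment-interior : ∀ {e e′ k k′} → 0 < k → k < plen H e → k′ ≤ plen H e′ →
                     vert (segment e′) k′ ≡ vert (segment e) k → e′ ≡ e × k′ ≡ k
  segment-interior {e} {e′} {k} {k′} 0<k k<size k′≤size eq with position-cases k′≤size
  ... | inj₁ refl = contradiction (trans (sym eq) (segment-start e′)) (pv-avoid H e _ _ (internal 0<k k<size))
  ... | inj₂ (inj₁ refl) = contradiction (trans (sym eq) (segment-end e′)) (pv-avoid H e _ _ (internal 0<k k<size))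
  ... | inj₂ (inj₂ (0<k′ , k′<size)) with pv-disj H e′ e _ _ (internal 0<k′ k′<size) (internal 0<k k<size) eq
  ...   | refl = refl , vert-injective (segment e) k′ k k′≤size (ℕₚ.<⇒≤ k<size) eq

module Lift {J G : Graph} (H : Bisubdivision J G)
            {M₀ : E G → Bool} (M₀-perfect : IsPerfectMatchingOn G (λ w → ¬ InH H w) M₀) where
  open Segments H
  open Path
  open GraphProperties G

  phase : Bool → Parity
  phase true  = 0ℙ
  phase false = 1ℙ

  Selected : (E J → Bool) → E G → Set
  Selected N h = ∃[ e ] ∃[ i ] pe H e i ≡ h × parity (toℕ i) ≡ phase (N e)

  selected? : ∀ N → Decidable (Selected N)
  selected? N h = Finₚ.any? λ e → Finₚ.any? λ i → (pe H e i Finₚ.≟ h) ×-dec (parity (toℕ i) ℙₚ.≟ phase (N e))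

  -- M₀ together with every other edge of each segment, starting with the first one exactly for the edges of N.
  lift : (E J → Bool) → E G → Bool
  lift N h = M₀ h ∨ does (selected? N h)

  lift-segment : ∀ N {e k} → k < plen H e → parity k ≡ phase (N e) → lift N (edge (segment e) k) ≡ true
  lift-segment N {e} {k} k<size pk = trans
    (cong (M₀ _ ∨_) (dec-true (selected? N _) (e , _ , refl , trans (cong parity (toℕ-clamp (ℕₚ.≤-pred k<size))) pk)))
    (Boolₚ.∨-zeroʳ _)

  private
    lift-cases : ∀ N {h} → lift N h ≡ true → M₀ h ≡ true ⊎ Selected N h
    lift-cases N {h} lift-h with M₀ h | selected? N h
    ... | true  | _ = inj₁ refl
    ... | false | yes s = inj₂ s
    ... | false | no _ = contradiction lift-h λ ()

    M₀-avoids-H : ∀ {f x} → M₀ f ≡ true → Inc G f x → ¬ InH H x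
    M₀-avoids-H {f} M₀f (inj₁ refl) = proj₁ (proj₁ M₀-perfect f M₀f)
    M₀-avoids-H {f} M₀f (inj₂ refl) = proj₂ (proj₁ M₀-perfect f M₀f)

    phase≡0ℙ : ∀ {b} → phase b ≡ 0ℙ → b ≡ true
    phase≡0ℙ {true} _ = refl

    touching-same-parity : ∀ {k k′ p} → p ≡ k ⊎ p ≡ suc k → p ≡ k′ ⊎ p ≡ suc k′ → parity k ≡ parity k′ → k ≡ k′
    touching-same-parity (inj₁ refl) (inj₁ refl) _ = refl
    touching-same-parity (inj₂ refl) (inj₂ refl) _ = refl
    touching-same-parity {k′ = k′} (inj₁ refl) (inj₂ refl) pk≡pk′ =
      contradiction (trans (sym (parity-suc k′)) pk≡pk′) (ℙₚ.p≢p⁻¹ (parity k′) ∘ sym)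
    touching-same-parity {k} (inj₂ refl) (inj₁ refl) pk≡pk′ =
      contradiction (trans pk≡pk′ (parity-suc k)) (ℙₚ.p≢p⁻¹ (parity k))

    end-edge-even : ∀ {k p m} → k < suc (2 * m) → p ≡ k ⊎ p ≡ suc k → p ≡ 0 ⊎ p ≡ suc (2 * m) → parity k ≡ 0ℙ
    end-edge-even _ (inj₁ refl) (inj₁ refl) = refl
    end-edge-even k<size (inj₁ refl) (inj₂ refl) = contradiction k<size (ℕₚ.<-irrefl refl)
    end-edge-even {m = m} _ (inj₂ refl) (inj₂ eq) =
      subst (λ k → parity k ≡ 0ℙ) (sym (ℕₚ.suc-injective eq)) (parity-double m)

  module _ {N : E J → Bool} (N-perfect : IsPerfectMatching J N) where

    private
      record Meeting (h : E G) (x : V G) : Set where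
        field
          e        : E J
          k p      : ℕ
          k<size   : k < plen H e
          touches  : p ≡ k ⊎ p ≡ suc k
          selected : parity k ≡ phase (N e)
          edge≡    : edge (segment e) k ≡ h
          vert≡    : vert (segment e) p ≡ x

        p≤size : p ≤ plen H e
        p≤size with touches
        ... | inj₁ p≡k = subst (_≤ plen H e) (sym p≡k) (ℕₚ.<⇒≤ k<size)
        ... | inj₂ p≡1+k = subst (_≤ plen H e) (sym p≡1+k) k<size

      meeting : ∀ {h x} → Selected N h → Inc G h x → Meeting h x
      meeting {x = x} (e , i , refl , pi) h∋x with joins-ends (joins (segment e) (toℕ i) (Finₚ.toℕ<n i))
                                                           (subst (λ h → Inc G h x) (pe≡segment-edge e i) h∋x)
      ... | inj₁ refl = record { e = e ; k = toℕ i ; p = toℕ i ; k<size = Finₚ.toℕ<n i ; touches = inj₁ refl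
                               ; selected = pi ; edge≡ = sym (pe≡segment-edge e i) ; vert≡ = refl }
      ... | inj₂ refl = record { e = e ; k = toℕ i ; p = suc (toℕ i) ; k<size = Finₚ.toℕ<n i ; touches = inj₂ refl
                               ; selected = pi ; edge≡ = sym (pe≡segment-edge e i) ; vert≡ = refl }

      meeting-∈H : ∀ {h x} → Meeting h x → InH H x
      meeting-∈H m = subst (InH H) (Meeting.vert≡ m) (segment-vert-∈H (Meeting.e m) (Meeting.p m))

      BranchEnd : E J → ℕ → V J → Set
      BranchEnd e p y = (p ≡ 0 × end₁ J e ≡ y) ⊎ (p ≡ plen H e × end₂ J e ≡ y)

      -- A selected edge at a branch vertex is an end edge of its segment, hence at an even position.
      meeting-branch : ∀ {h x y} → x ≡ φ H y → (m : Meeting h x) →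
                       N (Meeting.e m) ≡ true × BranchEnd (Meeting.e m) (Meeting.p m) y
      meeting-branch x≡φy m =
        phase≡0ℙ (trans (sym selected) (end-edge-even {m = len H e} k<size touches (Sum.map proj₁ proj₁ end))) , end
        where
        open Meeting m
        end = segment-branch p≤size (trans vert≡ x≡φy)

      branch-end-unique : ∀ {e p p′ y} → BranchEnd e p y → BranchEnd e p′ y → p ≡ p′
      branch-end-unique (inj₁ (refl , _)) (inj₁ (refl , _)) = refl
      branch-end-unique (inj₂ (refl , _)) (inj₂ (refl , _)) = refl
      branch-end-unique {e} (inj₁ (_ , e₁≡y)) (inj₂ (_ , e₂≡y)) = contradiction (trans e₁≡y (sym e₂≡y)) (loopless J e)
      branch-end-unique {e} (inj₂ (_ , e₂≡y)) (inj₁ (_ , e₁≡y)) = contradiction (trans e₁≡y (sym e₂≡y)) (loopless J e)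

      branch-end-inc : ∀ {e p y} → BranchEnd e p y → Inc J e y
      branch-end-inc = Sum.map proj₂ proj₂

      same-meeting : ∀ {h h′ x} (m : Meeting h x) (m′ : Meeting h′ x) →
                     Meeting.e m ≡ Meeting.e m′ → Meeting.p m ≡ Meeting.p m′ → h ≡ h′
      same-meeting m m′ refl refl = trans (sym (Meeting.edge≡ m))
        (trans (cong (edge (segment (Meeting.e m))) (touching-same-parity (Meeting.touches m) (Meeting.touches m′)
                  (trans (Meeting.selected m) (sym (Meeting.selected m′)))))
               (Meeting.edge≡ m′))

      -- At a branch vertex both J-edges lie in N and meet the same vertex of J, so they coincide.
      meetings-at-branch : ∀ {h h′ x y} → x ≡ φ H y → Meeting h x → Meeting h′ x → h ≡ h′
      meetings-at-branch x≡φy m m′ with meeting-branch x≡φy m | meeting-branch x≡φy m′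
      ... | Ne , end | Ne′ , end′ =
        same-meeting m m′ e≡e′ (branch-end-unique end (subst (λ e → BranchEnd e _ _) (sym e≡e′) end′))
        where e≡e′ = matching-edge-unique {J} {M = N} N-perfect tt Ne Ne′ (branch-end-inc end) (branch-end-inc end′)

      meetings-unique : ∀ {h h′ x} → Meeting h x → Meeting h′ x → h ≡ h′
      meetings-unique m m′ with position-cases (Meeting.p≤size m)
      ... | inj₁ p≡0 = meetings-at-branch
        (trans (sym (Meeting.vert≡ m)) (trans (cong (vert (segment _)) p≡0) (segment-start _))) m m′
      ... | inj₂ (inj₁ p≡size) = meetings-at-branch
        (trans (sym (Meeting.vert≡ m)) (trans (cong (vert (segment _)) p≡size) (segment-end _))) m m′
      ... | inj₂ (inj₂ (0<p , p<size))
        with segment-interior 0<p p<size (Meeting.p≤size m′) (trans (Meeting.vert≡ m′) (sym (Meeting.vert≡ m)))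
      ...   | e′≡e , p′≡p = same-meeting m m′ (sym e′≡e) (sym p′≡p)

      Matched : V G → Set
      Matched x = ∃[ h ] lift N h ≡ true × Inc G h x

      matched-outside : ∀ {x} → ¬ InH H x → Matched x
      matched-outside x∉H = let h , M₀h , h∋x , _ = proj₂ M₀-perfect _ x∉H in
        h , subst (λ b → b ∨ does (selected? N h) ≡ true) (sym M₀h) refl , h∋x

      matched-branch : ∀ y → Matched (φ H y)
      matched-branch y with proj₂ N-perfect y tt
      ... | e , Ne , inj₁ e₁≡y , _ = edge (segment e) 0 , lift-segment N (s≤s z≤n) (cong phase (sym Ne)) ,
        subst (Inc G _) (trans (segment-start e) (cong (φ H) e₁≡y)) (joins⇒inc (joins (segment e) 0 (s≤s z≤n)))
      ... | e , Ne , inj₂ e₂≡y , _ = edge (segment e) (2 * len H e) ,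
        lift-segment N ℕₚ.≤-refl (trans (parity-double (len H e)) (cong phase (sym Ne))) ,
        subst (Inc G _) (trans (segment-end e) (cong (φ H) e₂≡y))
              (joins⇒inc (joins-sym (joins (segment e) (2 * len H e) ℕₚ.≤-refl)))

      matched-interior : ∀ e {k} → 0 < k → k < plen H e → Matched (vert (segment e) k)
      matched-interior e {k} _ k<size with parity k ℙₚ.≟ phase (N e)
      ... | yes pk = edge (segment e) k , lift-segment N k<size pk , joins⇒inc (joins (segment e) k k<size)
      matched-interior e {suc k} _ k+1<size | no pk+1≢ =
        edge (segment e) k , lift-segment N k<size (parity[1+k]≢q⇒parity[k]≡q {k} pk+1≢) ,
        joins⇒inc (joins-sym (joins (segment e) k k<size))
        where k<size = ℕₚ.<-trans (ℕₚ.n<1+n k) k+1<size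

      matched : ∀ x → Matched x
      matched x with Finₚ.any? (λ y → φ H y Finₚ.≟ x)
      ... | yes (y , refl) = matched-branch y
      ... | no ¬branch with Finₚ.any? (λ e → Finₚ.any? (λ j → pv H e j Finₚ.≟ x))
      ...   | no ¬segment = matched-outside [ ¬branch , ¬segment ]
      ...   | yes (e , j , refl) rewrite pv≡segment-vert e j with position-cases (ℕₚ.≤-pred (Finₚ.toℕ<n j))
      ...     | inj₁ j≡0 =
        contradiction (end₁ J e , sym (trans (cong (vert (segment e)) j≡0) (segment-start e))) ¬branch
      ...     | inj₂ (inj₁ j≡size) =
        contradiction (end₂ J e , sym (trans (cong (vert (segment e)) j≡size) (segment-end e))) ¬branch
      ...     | inj₂ (inj₂ (0<j , j<size)) = matched-interior e 0<j j<size

      lift-unique : ∀ {f g x} → lift N f ≡ true → lift N g ≡ true → Inc G f x → Inc G g x → f ≡ g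
      lift-unique {f} {g} lift-f lift-g f∋x g∋x with lift-cases N lift-f | lift-cases N lift-g
      ... | inj₁ M₀f | inj₁ M₀g = matching-edge-unique {G} {M = M₀} M₀-perfect (M₀-avoids-H M₀f f∋x) M₀f M₀g f∋x g∋x
      ... | inj₁ M₀f | inj₂ sel-g = contradiction (meeting-∈H (meeting sel-g g∋x)) (M₀-avoids-H M₀f f∋x)
      ... | inj₂ sel-f | inj₁ M₀g = contradiction (meeting-∈H (meeting sel-f f∋x)) (M₀-avoids-H M₀g g∋x)
      ... | inj₂ sel-f | inj₂ sel-g = meetings-unique (meeting sel-f f∋x) (meeting sel-g g∋x)

    lift-perfect : IsPerfectMatching G (lift N)
    lift-perfect = (λ _ _ → tt , tt) , λ x _ →
      let h , lift-h , h∋x = matched x in h , lift-h , h∋x , λ g lift-g g∋x → lift-unique lift-g lift-h g∋x h∋x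

module EdgePaths {J G : Graph} (H : Bisubdivision J G) where
  open Segments H
  open Path

  record EdgePath (e : E J) (x y : V J) : Set where
    field
      path     : Path G
      start    : vert path 0 ≡ φ H x
      finish   : vert path (size path) ≡ φ H y
      size-odd : parity (size path) ≡ 1ℙ
      along    : ∀ k → k < size path →
                 ∃[ k′ ] k′ < plen H e × edge path k ≡ edge (segment e) k′ × parity k′ ≡ parity k

  forward : ∀ e → EdgePath e (end₁ J e) (end₂ J e)
  forward e = record
    { path     = segment e
    ; start    = segment-start e
    ; finish   = segment-end e
    ; size-odd = trans (parity-suc (2 * len H e)) (cong _⁻¹ (parity-double (len H e)))
    ; along    = λ k k<size → k , k<size , refl , refl
    }

  backward : ∀ {e x y} → EdgePath e x y → EdgePath e y x
  backward {e} P = record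
    { path     = reverse path
    ; start    = finish
    ; finish   = trans (cong (vert path) (ℕₚ.n∸n≡0 (size path))) start
    ; size-odd = size-odd
    ; along    = λ k k<size →
        let k′ , k′<size , eq , pk′ = along (size path ∸ suc k) (ℕₚ.∸-monoʳ-< (s≤s z≤n) k<size) in
        k′ , k′<size , eq , trans pk′ (reversed-parity k<size)
    }
    where
    open EdgePath P
    reversed-parity : ∀ {k} → k < size path → parity (size path ∸ suc k) ≡ parity k
    reversed-parity {k} k<size = begin
      parity (size path ∸ suc k)             ≡⟨ parity-∸ k<size ⟩
      parity (size path) ℙ.+ parity (suc k)  ≡⟨ cong₂ ℙ._+_ size-odd (parity-suc k) ⟩
      1ℙ ℙ.+ parity k ⁻¹                     ≡⟨ ℙₚ.⁻¹-selfInverse refl ⟩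
      parity k                               ∎
      where open ≡-Reasoning

  edgePath : ∀ {e x y} → Joins J e x y → EdgePath e x y
  edgePath {e} (inj₁ refl) = forward e
  edgePath {e} (inj₂ refl) = backward (forward e)

-- Exits from a component of G − B

other-edge-unmatched : ∀ {G N f g y} → IsPerfectMatching G N → N f ≡ true → Inc G f y → Inc G g y → g ≢ f →
                       N g ≡ false
other-edge-unmatched {G} {N} {g = g} N-perfect Nf f∋y g∋y g≢f with N g in Ng
... | false = refl
... | true = contradiction (matching-edge-unique {G} {M = N} N-perfect tt Ng Nf g∋y f∋y) g≢f

module Exits {J G : Graph} (J-covered : IsMatchingCovered J) (H : Bisubdivision J G)
             {M₀ : E G → Bool} (M₀-perfect : IsPerfectMatchingOn G (λ w → ¬ InH H w) M₀)
             {B : Subset (nv G)} (B-barrier : IsBarrier G B) where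
  open Segments H
  open Lift H M₀-perfect
  open EdgePaths H
  open EdgePath
  open Path
  open GraphProperties G

  private
    perfect-matching-with : ∀ f → ∃[ N ] IsPerfectMatching J N × N f ≡ true
    perfect-matching-with = proj₂ (proj₂ J-covered)

    lift-along : ∀ {e x y} (P : EdgePath e x y) N {k} → k < size (path P) → parity k ≡ phase (N e) →
                 lift N (edge (path P) k) ≡ true
    lift-along P N k<size pk = let _ , k′<size , eq , pk′ = along P _ k<size in
      subst (λ h → lift N h ≡ true) (sym eq) (lift-segment N k′<size (trans pk′ pk))

    first-exit : ∀ {e y z} (P : EdgePath e y z) → φ H y ∉ B → ¬ Reach G B (φ H y) (φ H z) →
                 ∃[ a ] a < size (path P) × Reach G B (φ H y) (vert (path P) a) × vert (path P) (suc a) ∈ B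
    first-exit P φy∉B φy≁φz =
      let a , _ , rest = PathProperties.exit (path P) z≤n ℕₚ.≤-refl
                           (subst (Reach G B _) (sym (start P)) (here φy∉B)) (φy≁φz ∘ subst (Reach G B _) (finish P))
      in a , rest

    selected-exits-same-edge : ∀ {e f x y x′ y′ a t N} (P : EdgePath e x y) (Q : EdgePath f x′ y′) →
      IsPerfectMatching J N → a < size (path P) → t < size (path Q) →
      parity a ≡ phase (N e) → parity t ≡ phase (N f) → Reach G B (vert (path P) a) (vert (path Q) t) →
      vert (path P) (suc a) ∈ B → vert (path Q) (suc t) ∈ B → e ≡ f
    selected-exits-same-edge P Q N-perfect a<size t<size pa pt vₐ~vₜ vₐ₊₁∈B vₜ₊₁∈B
      with along P _ a<size | along Q _ t<size
    ... | _ , _ , eqP , _ | _ , _ , eqQ , _ = segment-edges-disjoint (trans (sym eqP) (trans same-edge eqQ))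
      where
      same-edge = Barrier.matched-once-into-barrier B-barrier (lift-perfect N-perfect)
        (lift-along P _ a<size pa) (lift-along Q _ t<size pt)
        (joins (path P) _ a<size) (joins (path Q) _ t<size) vₐ~vₜ vₐ₊₁∈B vₜ₊₁∈B

    -- Through a third edge f₂ at y, both e and f₁ can be left unmatched.
    matching-avoiding-with-phase : ∀ q {e f₁ f₂ y} → Inc J e y → Inc J f₁ y → Inc J f₂ y → e ≢ f₁ → e ≢ f₂ → f₁ ≢ f₂ →
      ∃[ N ] IsPerfectMatching J N × N e ≡ false × phase (N f₁) ≡ q
    matching-avoiding-with-phase 0ℙ {f₁ = f₁} e∋y f₁∋y _ e≢f₁ _ _ with perfect-matching-with f₁
    ... | N , N-perfect , Nf₁ =
      N , N-perfect , other-edge-unmatched {J} {N} N-perfect Nf₁ f₁∋y e∋y e≢f₁ , cong phase Nf₁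
    matching-avoiding-with-phase 1ℙ {f₂ = f₂} e∋y f₁∋y f₂∋y _ e≢f₂ f₁≢f₂ with perfect-matching-with f₂
    ... | N , N-perfect , Nf₂ =
      N , N-perfect , other-edge-unmatched {J} {N} N-perfect Nf₂ f₂∋y e∋y e≢f₂ ,
      cong phase (other-edge-unmatched {J} {N} N-perfect Nf₂ f₂∋y f₁∋y f₁≢f₂)

    exit-position-even : ∀ {e y z a} → 3 ≤ degree J y → φ H y ∉ B → (∀ x → Reach G B (φ H y) (φ H x) → x ≡ y) →
      Inc J e y → (P : EdgePath e y z) → a < size (path P) → Reach G B (φ H y) (vert (path P) a) →
      vert (path P) (suc a) ∈ B → parity a ≡ 0ℙ
    exit-position-even {e} {y} {a = a} deg≥3 φy∉B only-y e∋y P a<size φy~vₐ vₐ₊₁∈B with parity a ℙₚ.≟ 0ℙ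
    ... | yes pa≡0 = pa≡0
    ... | no pa≢0
      with incident-edge-∉ J (e ∷ []) (ℕₚ.<-≤-trans (s≤s (s≤s z≤n)) deg≥3)
    ... | f₁ , f₁∋y , f₁∉[e]
      with incident-edge-∉ J (e ∷ f₁ ∷ []) deg≥3 | GraphProperties.inc⇒joins J f₁∋y
    ... | f₂ , f₂∋y , f₂∉[e,f₁] | y′ , f₁∶yy′
      with first-exit (edgePath f₁∶yy′) φy∉B (λ r → GraphProperties.joins⇒≢ J f₁∶yy′ (sym (only-y y′ r)))
    ... | t , t<size , φy~vₜ , vₜ₊₁∈B
      with matching-avoiding-with-phase (parity t) e∋y f₁∋y f₂∋y (f₁∉[e] ∘ here ∘ sym) (f₂∉[e,f₁] ∘ here ∘ sym)
                                        (f₂∉[e,f₁] ∘ there ∘ here ∘ sym)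
    ... | N , N-perfect , Ne , Nf₁ = ⊥-elim (f₁∉[e] (here (sym (selected-exits-same-edge P (edgePath f₁∶yy′) N-perfect
            a<size t<size (trans (p≢q⇒p≡q⁻¹ pa≢0) (cong phase (sym Ne))) (sym Nf₁)
            (reach-trans (reach-sym φy~vₐ) φy~vₜ) vₐ₊₁∈B vₜ₊₁∈B))))

  odd-barrier-position : ∀ {e y z} → 3 ≤ degree J y → φ H y ∉ B → (∀ x → Reach G B (φ H y) (φ H x) → x ≡ y) →
    ¬ Reach G B (φ H y) (φ H z) → Inc J e y → (P : EdgePath e y z) →
    ∃[ c ] c ≤ size (path P) × vert (path P) c ∈ B × parity c ≡ 1ℙ
  odd-barrier-position deg≥3 φy∉B only-y φy≁φz e∋y P =
    let a , a<size , φy~vₐ , vₐ₊₁∈B = first-exit P φy∉B φy≁φz in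
    suc a , a<size , vₐ₊₁∈B ,
    trans (parity-suc a) (cong _⁻¹ (exit-position-even deg≥3 φy∉B only-y e∋y P a<size φy~vₐ vₐ₊₁∈B))

  alternating-lifts : ∀ {e x y} → 2 ≤ degree J x → Inc J e x → (P : EdgePath e x y) →
    ∃[ M ] (∀ p → IsPerfectMatching G (M p)) × (∀ k → k < size (path P) → M (parity k) (edge (path P) k) ≡ true)
  alternating-lifts {e} deg≥2 e∋x P with incident-edge-∉ J (e ∷ []) deg≥2 | perfect-matching-with e
  ... | f , f∋x , f∉[e] | N₀ , N₀-perfect , N₀e with perfect-matching-with f
  ... | N₁ , N₁-perfect , N₁f = M , M-perfect , alternates
    where
    N₁e = other-edge-unmatched {J} {N₁} N₁-perfect N₁f f∋x e∋x (f∉[e] ∘ here ∘ sym)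

    M : Parity → E G → Bool
    M 0ℙ = lift N₀
    M 1ℙ = lift N₁

    M-perfect : ∀ p → IsPerfectMatching G (M p)
    M-perfect 0ℙ = lift-perfect N₀-perfect
    M-perfect 1ℙ = lift-perfect N₁-perfect

    alternates : ∀ k → k < size (path P) → M (parity k) (edge (path P) k) ≡ true
    alternates k k<size with parity k in pk
    ... | 0ℙ = lift-along P N₀ k<size (trans pk (cong phase (sym N₀e)))
    ... | 1ℙ = lift-along P N₁ k<size (trans pk (cong phase (sym N₁e)))

lemma38 : (J G : Graph) → IsMatchingCovered J → MinDegreeAtLeast 3 J →
    IsMatchingCovered G → (H : Bisubdivision J G) → IsConformal H →
    (B : Subset (nv G)) → IsBarrier G B →
    (u v : V J) → φ H u ∉ B → φ H v ∉ B →
    ¬ Reach G B (φ H u) (φ H v) →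
    (∀ x → Reach G B (φ H u) (φ H x) → x ≡ u) →
    (∀ x → Reach G B (φ H v) (φ H x) → x ≡ v) →
    ¬ Adjacent J u v
lemma38 J G J-covered deg≥3 G-covered H (_ , M₀-perfect) B B-barrier u v φu∉B φv∉B φu≁φv only-u only-v (e , e∶uv) =
  let c , c≤size , v[c]∈B , c-odd = odd-barrier-position (deg≥3 u) φu∉B only-u φu≁φv e∋u P
      d , d≤size , v[size∸d]∈B , d-odd = odd-barrier-position (deg≥3 v) φv∉B only-v (φu≁φv ∘ reach-sym) e∋v (backward P)
      M , M-perfect , alternating = alternating-lifts (ℕₚ.<⇒≤ (deg≥3 u)) e∋u P
  in  contradiction (begin
        1ℙ                          ≡⟨ sym c-odd ⟩
        parity c                    ≡⟨ barrier-positions-same-parity G-covered B-barrier (path P) M M-perfect alternating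
                                         c≤size (ℕₚ.m∸n≤m _ d) v[c]∈B v[size∸d]∈B ⟩
        parity (size (path P) ∸ d)  ≡⟨ trans (parity-∸ d≤size) (cong₂ ℙ._+_ (size-odd P) d-odd) ⟩
        0ℙ                          ∎) λ ()
  where
  open Exits J-covered H M₀-perfect B-barrier
  open EdgePaths H
  open EdgePath
  open Path
  open GraphProperties G using (reach-sym)
  open ≡-Reasoning
  P = edgePath e∶uv
  e∋u = GraphProperties.joins⇒inc J e∶uv
  e∋v = GraphProperties.joins⇒inc J (GraphProperties.joins-sym J e∶uv)
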